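{- Let $p,a,b$ be integers with $2\le a\le b\le p$. (i) If $ab\ge 2p$, then $r\!\left(K_{n,n},K_{p,p},p^2-ab+2\right)=\Omega\!\left(n^{1/a}\right)$. (ii) If $a(2p-a-2)\ge 2p-1$, then $r\!\left(K_{n,n},K_{p,p},p^2-a(2p-a-2)+1\right)=\Omega\!\left(n^{1/a}\right)$.
   Context: For graphs $G,H$ and an integer $q$ with $2\le q\le |E(H)|$, an $(H,q)$-coloring of $G$ is an edge-coloring of $G$ in which every subgraph of $G$ isomorphic to $H$ receives at least $q$ distinct colors; $r(G,H,q)$ is the minimum number of colors needed for $G$ to have an $(H,q)$-coloring. $K_{n,n}$, $K_{p,p}$ denote complete bipartite graphs. Asymptotic notation refers to $n\to\infty$ with $p,a,b$ fixed. -}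

module Defs where

open import Data.Nat using (ℕ; _+_; _*_; _<ᵇ_)
open import Data.Fin using (Fin; toℕ)
open import Data.Bool using (Bool; true; _xor_)
open import Data.Product using (Σ; _×_; _,_; proj₁; proj₂)
open import Relation.Binary.PropositionalEquality using (_≡_; _≢_)
open import Function.Definitions using (Injective)

record Graph : Set where
  field
    V   : ℕ
    adj : Fin V → Fin V → Bool
open Graph public

-- Complete bipartite graph K_{n,n}: vertices Fin (n + n); vertices with index < n
-- form one part, the others the second part; u ~ v iff they lie in different parts.
K : ℕ → Graph
K n = record { V = n + n ; adj = λ u v → (toℕ u <ᵇ n) xor (toℕ v <ᵇ n) }

-- An edge-colouring of G with (at most) k colours: a colour for every
-- (unordered) pair of vertices, given symmetrically; only values on edges matter.
record EdgeColouring (G : Graph) (k : ℕ) : Set where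
  field
    col   : Fin (V G) → Fin (V G) → Fin k
    symm  : ∀ u v → col u v ≡ col v u
open EdgeColouring public

record Copy (H G : Graph) : Set where
  field
    φ     : Fin (V H) → Fin (V G)
    inj   : Injective _≡_ _≡_ φ
    hom   : ∀ x y → adj H x y ≡ true → adj G (φ x) (φ y) ≡ true
open Copy public

AtLeastColours : {H G : Graph} {k : ℕ} → EdgeColouring G k → Copy H G → ℕ → Set
AtLeastColours {H} c h q =
  Σ (Fin q → Fin (V H) × Fin (V H)) λ e →
    (∀ i → adj H (proj₁ (e i)) (proj₂ (e i)) ≡ true) ×
    (∀ i j → i ≢ j →
       col c (φ h (proj₁ (e i))) (φ h (proj₂ (e i))) ≢
       col c (φ h (proj₁ (e j))) (φ h (proj₂ (e j))))

IsHqColouring : (G H : Graph) (q k : ℕ) → EdgeColouring G k → Set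
IsHqColouring G H q k c = (h : Copy H G) → AtLeastColours c h q

-- G has an (H,q)-colouring using at most k colours.  r(G,H,q) is the least such k;
-- so "r(G,H,q) ≥ m" is equivalent to: every k admitting one satisfies k ≥ m.
HasHqColouring : (G H : Graph) (q k : ℕ) → Set
HasHqColouring G H q k = Σ (EdgeColouring G k) (IsHqColouring G H q k)

module Submission where

-- View the edges between the two sides of K_{n,n} as an n × n colour matrix.  A copy of
-- K_{p,p} whose colours can all be read off a palette of fewer than q entries violates the
-- (K_{p,p}, q)-property by the pigeonhole principle, so it suffices to find such copies.
--
-- (i) If there is no monochromatic K_{a,b}, counting for each colour c the stars
-- (x₁ … x_a , y) with all ψ xᵢ y ≡ c gives Σ_y d_c(y)^a ≤ (a² + b) m^a, where d_c(y) is the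
-- number of c-entries in column y.  As Σ_c Σ_y d_c(y) = m², the power-mean inequality then forces
-- m ≤ (a² + b) k^a (Kővári–Sós–Turán).  Hence for n large there is a monochromatic K_{a,b}, and
-- padding it with p − a rows and p − b columns gives a K_{p,p} with at most 1 + (p² − ab) colours.
-- (ii) Fix a rows.  Iterated pigeonhole gives p columns on each of which every fixed row is
-- constant, and then p − a further rows on which each of the first a of those columns is
-- constant.  This K_{p,p} has at most 2a + (p − a)² = p² − a(2p − a − 2) colours.

open import Defs
open import Data.Bool using (Bool; true; false; _∧_; _xor_)
open import Data.Empty using (⊥-elim)
open import Data.Fin using (Fin; zero; suc; toℕ; inject≤; lift; splitAt; join; _↑ˡ_; _↑ʳ_)
import Data.Fin.Properties as Finₚ
open Finₚ using (_≟_; any?; +↔⊎; *↔×; 1↔⊤; splitAt-join; pigeonhole; inject≤-injective;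
                 lift-injective; suc-injective)
open import Data.Nat using (ℕ; zero; suc; _+_; _*_; _∸_; _^_; _≤_; _<_; z≤n; s≤s; s≤s⁻¹; _≤?_; _<ᵇ_)
open import Data.Nat.Properties hiding (_≟_; suc-injective)
open import Data.Nat.Tactic.RingSolver using (solve-∀)
open import Data.Product using (Σ; _×_; _,_; proj₁; proj₂; uncurry)
open import Data.Product.Function.NonDependent.Propositional using (_×-↔_)
open import Data.Sum as Sum using (_⊎_; inj₁; inj₂)
open import Data.Sum.Function.Propositional using (_⊎-↔_)
open import Data.Sum.Properties using (inj₁-injective; inj₂-injective)
open import Data.Unit using (⊤; tt)
open import Data.Vec.Functional using (_∷_)
open import Function using (_∘_; id)
open import Function.Bundles using (Injection; _↣_; Inverse; _↔_)
open import Function.Construct.Composition using (_↔-∘_)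
open import Function.Construct.Identity using (↔-id)
open import Function.Construct.Symmetry using (↔-sym)
open import Function.Definitions using (Injective)
open import Function.Properties.Inverse using (↔⇒↣)
open import Level using (0ℓ)
open import Relation.Binary.PropositionalEquality
open import Relation.Nullary using (¬_; yes; no)
open import Relation.Nullary.Decidable using (does; _×-dec_; dec-true)
open import Relation.Unary using (Pred; Decidable)
open import Relation.Unary.Properties using (U?)

open import Algebra.Properties.Semiring.Sum +-*-semiring
  using (sum; sum-syntax; ∑-comm; ∑-distrib-+; *-distribˡ-sum; *-distribʳ-sum; sum-cong-≗)

sum-mono-≤ : ∀ {n} {f g : Fin n → ℕ} → (∀ i → f i ≤ g i) → sum f ≤ sum g
sum-mono-≤ {zero}  f≤g = z≤n
sum-mono-≤ {suc n} f≤g = +-mono-≤ (f≤g zero) (sum-mono-≤ (f≤g ∘ suc))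

sum-const : ∀ n c → ∑[ i < n ] c ≡ n * c
sum-const zero    c = refl
sum-const (suc n) c = cong (c +_) (sum-const n c)

≤-sum : ∀ {n} (f : Fin n → ℕ) i → f i ≤ sum f
≤-sum f zero    = m≤m+n (f zero) _
≤-sum f (suc i) = ≤-trans (≤-sum (f ∘ suc) i) (m≤n+m _ (f zero))

sum-product : ∀ {n} (t u : Fin n → ℕ) → sum t * sum u ≡ ∑[ i < n ] ∑[ j < n ] (t i * u j)
sum-product t u = trans (*-distribʳ-sum (sum u) t) (sum-cong-≗ λ i → *-distribˡ-sum (t i) u)

indicator : Bool → ℕ
indicator true  = 1
indicator false = 0

indicator≤1 : ∀ b → indicator b ≤ 1
indicator≤1 true  = ≤-refl
indicator≤1 false = z≤n

indicator-∧ : ∀ x y → indicator (x ∧ y) ≡ indicator x * indicator y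
indicator-∧ true  y = sym (+-identityʳ (indicator y))
indicator-∧ false y = refl

∑-indicator-≟ : ∀ {n} (x : Fin n) → ∑[ y < n ] indicator (does (x ≟ y)) ≡ 1
∑-indicator-≟ {suc n} zero    = cong suc (trans (sum-const n 0) (*-zeroʳ n))
∑-indicator-≟ {suc n} (suc x) = ∑-indicator-≟ x

count : ∀ {n p} {P : Pred (Fin n) p} → Decidable P → ℕ
count {n} P? = ∑[ y < n ] indicator (does (P? y))

count≤ : ∀ {n p} {P : Pred (Fin n) p} (P? : Decidable P) → count P? ≤ n
count≤ {n} P? = begin
  ∑[ y < n ] indicator (does (P? y)) ≤⟨ sum-mono-≤ (indicator≤1 ∘ does ∘ P?) ⟩
  ∑[ y < n ] 1                       ≡⟨ sum-const n 1 ⟩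
  n * 1                              ≡⟨ *-identityʳ n ⟩
  n                                  ∎
  where open ≤-Reasoning

select : ∀ {n p} {P : Pred (Fin n) p} (P? : Decidable P) {s} → s ≤ count P? →
         Σ (Fin s → Fin n) λ E → Injective _≡_ _≡_ E × (∀ j → P (E j))
select P? {zero} _ = (λ ()) , (λ { {()} }) , λ ()
select {suc n} P? {suc s} s≤#P with P? zero
... | yes P₀ = let E , E-injective , E-P = select (P? ∘ suc) (s≤s⁻¹ s≤#P) in
               lift 1 E , lift-injective E E-injective 1 , λ { zero → P₀ ; (suc j) → E-P j }
... | no _   = let E , E-injective , E-P = select (P? ∘ suc) s≤#P in
               suc ∘ E , E-injective ∘ suc-injective , E-P

sum-mono-< : ∀ {n} {f g : Fin (suc n) → ℕ} → (∀ i → f i < g i) → sum f < sum g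
sum-mono-< f<g = +-mono-<-≤ (f<g zero) (sum-mono-≤ (<⇒≤ ∘ f<g ∘ suc))

∑-fibres : ∀ {n k} (f : Fin n → Fin k) → ∑[ c < k ] count (λ y → f y ≟ c) ≡ n
∑-fibres {n} {k} f = begin
  ∑[ c < k ] ∑[ y < n ] indicator (does (f y ≟ c)) ≡⟨ ∑-comm (λ c y → indicator (does (f y ≟ c))) ⟩
  ∑[ y < n ] ∑[ c < k ] indicator (does (f y ≟ c)) ≡⟨ sum-cong-≗ (∑-indicator-≟ ∘ f) ⟩
  ∑[ y < n ] 1                                      ≡⟨ sum-const n 1 ⟩
  n * 1                                             ≡⟨ *-identityʳ n ⟩
  n                                                 ∎
  where open ≡-Reasoning

-- Pigeonhole

pigeonhole-fibre : ∀ {n k} (f : Fin n → Fin (suc k)) {s} → suc k * s ≤ n →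
                   Σ (Fin (suc k)) λ c → Σ (Fin s → Fin n) λ E →
                     Injective _≡_ _≡_ E × (∀ j → f (E j) ≡ c)
pigeonhole-fibre {k = k} f {s} ks≤n with any? (λ c → s ≤? count (λ y → f y ≟ c))
... | yes (c , s≤#c) = c , select (λ y → f y ≟ c) s≤#c
... | no none = ⊥-elim (<⇒≱ ∑fibres<ks (≤-trans ks≤n (≤-reflexive (sym (∑-fibres f)))))
  where
  ∑fibres<ks : ∑[ c < suc k ] count (λ y → f y ≟ c) < suc k * s
  ∑fibres<ks = <-≤-trans (sum-mono-< (λ c → ≰⇒> (none ∘ (c ,_)))) (≤-reflexive (sum-const (suc k) s))

inject≤-injective′ : ∀ {m n} .(m≤n : m ≤ n) → Injective _≡_ _≡_ (λ (i : Fin m) → inject≤ i m≤n)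
inject≤-injective′ m≤n {i} {j} = inject≤-injective m≤n m≤n i j

record ConstantSubset {a n k} (h : Fin a → Fin n → Fin k) (s : ℕ) : Set where
  field
    colour           : Fin a → Fin k
    points           : Fin s → Fin n
    points-injective : Injective _≡_ _≡_ points
    constant         : ∀ i j → h i (points j) ≡ colour i

iterated-pigeonhole : ∀ a {n k s} (h : Fin a → Fin n → Fin (suc k)) → suc k ^ a * s ≤ n →
                      ConstantSubset h s
iterated-pigeonhole zero {n} {s = s} h s≤n = record
  { colour           = λ ()
  ; points           = λ j → inject≤ j s≤n′
  ; points-injective = inject≤-injective′ s≤n′
  ; constant         = λ ()
  }
  where s≤n′ = subst (_≤ n) (+-identityʳ s) s≤n
iterated-pigeonhole (suc a) {n} {k} {s} h ks≤n =
  let c₀ , E₀ , E₀-injective , E₀-colour =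
        pigeonhole-fibre (h zero) (subst (_≤ n) (*-assoc (suc k) (suc k ^ a) s) ks≤n)
      open ConstantSubset (iterated-pigeonhole a (λ i y → h (suc i) (E₀ y)) ≤-refl)
  in record
       { colour           = c₀ ∷ colour
       ; points           = E₀ ∘ points
       ; points-injective = points-injective ∘ E₀-injective
       ; constant         = λ { zero j → E₀-colour (points j) ; (suc i) j → constant i j }
       }

-- Chebyshev's sum inequality and the power-mean inequality

^-distrib-* : ∀ x y n → (x * y) ^ n ≡ x ^ n * y ^ n
^-distrib-* x y zero    = refl
^-distrib-* x y (suc n) = trans (cong (x * y *_) (^-distrib-* x y n)) (identity x y (x ^ n) (y ^ n))
  where
  identity : ∀ x y X Y → x * y * (X * Y) ≡ x * X * (y * Y)
  identity = solve-∀

rearrangement : ∀ {a b c d} → a ≤ b → c ≤ d → a * d + b * c ≤ a * c + b * d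
rearrangement {a} {c = c} a≤b c≤d with m≤n⇒∃[o]m+o≡n a≤b | m≤n⇒∃[o]m+o≡n c≤d
... | x , refl | y , refl = subst (a * (c + y) + (a + x) * c ≤_) (identity a c x y) (m≤m+n _ (x * y))
  where
  identity : ∀ a c x y → a * (c + y) + (a + x) * c + x * y ≡ a * c + (a + x) * (c + y)
  identity = solve-∀

chebyshev : ∀ {n} (t u : Fin n → ℕ) → (∀ i j → t i ≤ t j → u i ≤ u j) →
            sum t * sum u ≤ n * ∑[ i < n ] (t i * u i)
chebyshev {n} t u similar = *-cancelˡ-≤ 2 (begin
  2 * (sum t * sum u)            ≡⟨ double (sum t * sum u) ⟩
  sum t * sum u + sum t * sum u  ≡⟨ cong (sum t * sum u +_) (*-comm (sum t) (sum u)) ⟩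
  sum t * sum u + sum u * sum t
    ≡⟨ cong₂ _+_ (sum-product t u) (trans (sum-product u t) (sum-cong-≗ λ i → sum-cong-≗ λ j → *-comm (u i) (t j))) ⟩
  ∑[ i < n ] ∑[ j < n ] (t i * u j) + ∑[ i < n ] ∑[ j < n ] (t j * u i)
    ≡⟨ trans (sum-cong-≗ λ i → ∑-distrib-+ (λ j → t i * u j) (λ j → t j * u i))
             (∑-distrib-+ (λ i → ∑[ j < n ] (t i * u j)) (λ i → ∑[ j < n ] (t j * u i))) ⟨
  ∑[ i < n ] ∑[ j < n ] (t i * u j + t j * u i)
    ≤⟨ sum-mono-≤ (λ i → sum-mono-≤ λ j → rearrange i j) ⟩
  ∑[ i < n ] ∑[ j < n ] (t i * u i + t j * u j)
    ≡⟨ trans (sum-cong-≗ λ i → ∑-distrib-+ (λ j → t i * u i) (λ j → t j * u j))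
             (∑-distrib-+ (λ i → ∑[ j < n ] (t i * u i)) (λ i → ∑[ j < n ] (t j * u j))) ⟩
  ∑[ i < n ] ∑[ j < n ] (t i * u i) + ∑[ i < n ] ∑[ j < n ] (t j * u j)
    ≡⟨ cong₂ _+_ (trans (sum-cong-≗ λ i → sum-const n (t i * u i)) (sym (*-distribˡ-sum n (λ i → t i * u i))))
                 (sum-const n _) ⟩
  n * ∑[ i < n ] (t i * u i) + n * ∑[ i < n ] (t i * u i)      ≡⟨ double (n * ∑[ i < n ] (t i * u i)) ⟨
  2 * (n * ∑[ i < n ] (t i * u i))                             ∎)
  where
  open ≤-Reasoning
  double : ∀ x → 2 * x ≡ x + x
  double x = cong (x +_) (+-identityʳ x)
  rearrange : ∀ i j → t i * u j + t j * u i ≤ t i * u i + t j * u j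
  rearrange i j with ≤-total (t i) (t j)
  ... | inj₁ tᵢ≤tⱼ = rearrangement tᵢ≤tⱼ (similar i j tᵢ≤tⱼ)
  ... | inj₂ tⱼ≤tᵢ = subst₂ _≤_ (+-comm (t j * u i) (t i * u j)) (+-comm (t j * u j) (t i * u i))
                             (rearrangement tⱼ≤tᵢ (similar j i tⱼ≤tᵢ))

power-mean : ∀ {n} (t : Fin n → ℕ) e → sum t ^ suc e ≤ n ^ e * ∑[ i < n ] (t i ^ suc e)
power-mean {n} t zero = ≤-reflexive (begin
  sum t * 1                  ≡⟨ *-identityʳ (sum t) ⟩
  sum t                      ≡⟨ sum-cong-≗ (λ i → *-identityʳ (t i)) ⟨
  ∑[ i < n ] (t i ^ 1)       ≡⟨ +-identityʳ _ ⟨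
  1 * ∑[ i < n ] (t i ^ 1)   ∎)
  where open ≡-Reasoning
power-mean {n} t (suc e) = begin
  sum t * sum t ^ suc e                             ≤⟨ *-monoʳ-≤ (sum t) (power-mean t e) ⟩
  sum t * (n ^ e * ∑[ i < n ] (t i ^ suc e))        ≡⟨ x*[y*z]≡y*[x*z] (sum t) (n ^ e) _ ⟩
  n ^ e * (sum t * ∑[ i < n ] (t i ^ suc e))
    ≤⟨ *-monoʳ-≤ (n ^ e) (chebyshev t (λ i → t i ^ suc e) (λ i j → ^-monoˡ-≤ (suc e))) ⟩
  n ^ e * (n * ∑[ i < n ] (t i * t i ^ suc e))      ≡⟨ *-assoc (n ^ e) n _ ⟨
  n ^ e * n * ∑[ i < n ] (t i ^ suc (suc e))        ≡⟨ cong (_* ∑[ i < n ] (t i ^ suc (suc e))) (*-comm (n ^ e) n) ⟩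
  n ^ suc e * ∑[ i < n ] (t i ^ suc (suc e))        ∎
  where
  open ≤-Reasoning
  x*[y*z]≡y*[x*z] : ∀ x y z → x * (y * z) ≡ y * (x * z)
  x*[y*z]≡y*[x*z] = solve-∀

-- The Kővári–Sós–Turán theorem

record MonochromaticBiclique {m n k} (ψ : Fin m → Fin n → Fin k) (a b : ℕ) : Set where
  field
    colour         : Fin k
    rows           : Fin a → Fin m
    cols           : Fin b → Fin n
    rows-injective : Injective _≡_ _≡_ rows
    cols-injective : Injective _≡_ _≡_ cols
    monochromatic  : ∀ i j → ψ (rows i) (cols j) ≡ colour

count-image : ∀ {m j} (D : Fin j → Fin m) → count (λ x → any? (λ i → D i ≟ x)) ≤ j
count-image {m} {j} D = begin
  ∑[ x < m ] indicator (does (any? (λ i → D i ≟ x)))  ≤⟨ sum-mono-≤ hit≤hits ⟩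
  ∑[ x < m ] ∑[ i < j ] indicator (does (D i ≟ x))    ≡⟨ ∑-comm (λ x i → indicator (does (D i ≟ x))) ⟩
  ∑[ i < j ] ∑[ x < m ] indicator (does (D i ≟ x))    ≡⟨ sum-cong-≗ (∑-indicator-≟ ∘ D) ⟩
  ∑[ i < j ] 1                                        ≡⟨ trans (sum-const j 1) (*-identityʳ j) ⟩
  j                                                   ∎
  where
  open ≤-Reasoning
  hit≤hits : ∀ x → indicator (does (any? (λ i → D i ≟ x))) ≤ ∑[ i < j ] indicator (does (D i ≟ x))
  hit≤hits x with any? (λ i → D i ≟ x)
  ... | no _           = z≤n
  ... | yes (i , refl) = ≤-trans (≤-reflexive (cong indicator (sym (dec-true (D i ≟ D i) refl))))
                                 (≤-sum (λ i′ → indicator (does (D i′ ≟ D i))) i)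

∷-injective : ∀ {m j} {x : Fin m} {D : Fin j → Fin m} →
              (∀ i → D i ≢ x) → Injective _≡_ _≡_ D → Injective _≡_ _≡_ (x ∷ D)
∷-injective x∉D D-injective {zero}  {zero}  _  = refl
∷-injective x∉D D-injective {zero}  {suc i} eq = ⊥-elim (x∉D i (sym eq))
∷-injective x∉D D-injective {suc i} {zero}  eq = ⊥-elim (x∉D i eq)
∷-injective x∉D D-injective {suc i} {suc j} eq = cong suc (D-injective eq)

module _ {m k} (ψ : Fin m → Fin m → Fin k) where

  degree : Fin k → Fin m → ℕ
  degree c y = count (λ x → ψ x y ≟ c)

  -- stars r c P? counts the tuples (x₁ … xᵣ , y) with P y and every ψ xᵢ y ≡ c.
  stars : ℕ → Fin k → {P : Pred (Fin m) 0ℓ} → Decidable P → ℕ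
  stars zero    c P? = count P?
  stars (suc r) c P? = ∑[ x < m ] stars r c (λ y → P? y ×-dec ψ x y ≟ c)

  stars-degree : ∀ r c {P} (P? : Decidable P) →
                 stars r c P? ≡ ∑[ y < m ] (indicator (does (P? y)) * degree c y ^ r)
  stars-degree zero    c P? = sum-cong-≗ λ y → sym (*-identityʳ (indicator (does (P? y))))
  stars-degree (suc r) c P? = begin
    ∑[ x < m ] stars r c (λ y → P? y ×-dec ψ x y ≟ c)
      ≡⟨ sum-cong-≗ (λ x → trans (stars-degree r c (λ y → P? y ×-dec ψ x y ≟ c)) (sum-cong-≗ (regroup x))) ⟩
    ∑[ x < m ] ∑[ y < m ] (weight y * hit x y)
      ≡⟨ ∑-comm (λ x y → weight y * hit x y) ⟩
    ∑[ y < m ] ∑[ x < m ] (weight y * hit x y)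
      ≡⟨ sum-cong-≗ (λ y → sym (*-distribˡ-sum (weight y) (λ x → hit x y))) ⟩
    ∑[ y < m ] (weight y * degree c y)
      ≡⟨ sum-cong-≗ (λ y → *-assoc (indicator (does (P? y))) (degree c y ^ r) (degree c y)) ⟩
    ∑[ y < m ] (indicator (does (P? y)) * (degree c y ^ r * degree c y))
      ≡⟨ sum-cong-≗ (λ y → cong (indicator (does (P? y)) *_) (*-comm (degree c y ^ r) (degree c y))) ⟩
    ∑[ y < m ] (indicator (does (P? y)) * degree c y ^ suc r) ∎
    where
    open ≡-Reasoning
    weight = λ y → indicator (does (P? y)) * degree c y ^ r
    hit = λ x y → indicator (does (ψ x y ≟ c))
    x*y*z≡x*z*y : ∀ x y z → x * y * z ≡ x * z * y
    x*y*z≡x*z*y = solve-∀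
    regroup : ∀ x y → indicator (does (P? y) ∧ does (ψ x y ≟ c)) * degree c y ^ r ≡ weight y * hit x y
    regroup x y = begin
      indicator (does (P? y) ∧ does (ψ x y ≟ c)) * degree c y ^ r
        ≡⟨ cong (_* degree c y ^ r) (indicator-∧ (does (P? y)) (does (ψ x y ≟ c))) ⟩
      indicator (does (P? y)) * hit x y * degree c y ^ r
        ≡⟨ x*y*z≡x*z*y (indicator (does (P? y))) (hit x y) (degree c y ^ r) ⟩
      weight y * hit x y ∎

  stars≤ : ∀ r c {P} (P? : Decidable P) → stars r c P? ≤ m ^ suc r
  stars≤ zero    c P? = ≤-trans (count≤ P?) (≤-reflexive (sym (*-identityʳ m)))
  stars≤ (suc r) c P? = ≤-trans (sum-mono-≤ λ x → stars≤ r c (λ y → P? y ×-dec ψ x y ≟ c))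
                                (≤-reflexive (sum-const m (m ^ suc r)))

  -- Given j distinct rows, a further row either repeats one of them (trivial bound, at most
  -- j ≤ a times) or extends them; with a distinct rows, fewer than b columns can be common c-columns.
  stars-bound : ∀ {a b} c r {j} (D : Fin j → Fin m) → Injective _≡_ _≡_ D → j + r ≡ a →
                {P : Pred (Fin m) 0ℓ} (P? : Decidable P) → (∀ y → P y → ∀ i → ψ (D i) y ≡ c) →
                ¬ MonochromaticBiclique ψ a b → stars r c P? ≤ (a * r + b) * m ^ r
  stars-bound {a} {b} c zero {j} D D-injective j+0≡a P? D-P no-biclique
    with trans (sym (+-identityʳ j)) j+0≡a
  ... | refl with b ≤? count P?
  ...   | yes b≤#P = let E , E-injective , E-P = select P? b≤#P in
                     ⊥-elim (no-biclique record
                       { colour = c ; rows = D ; cols = E ; rows-injective = D-injective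
                       ; cols-injective = E-injective ; monochromatic = λ i j → D-P (E j) (E-P j) i })
  ...   | no b≰#P = ≤-trans (<⇒≤ (≰⇒> b≰#P))
                            (≤-reflexive (sym (trans (*-identityʳ _) (cong (_+ b) (*-zeroʳ a)))))
  stars-bound {a} {b} c (suc r) {j} D D-injective j+r≡a {P} P? D-P no-biclique = begin
    ∑[ x < m ] stars r c (λ y → P? y ×-dec ψ x y ≟ c)
      ≤⟨ sum-mono-≤ row-bound ⟩
    ∑[ x < m ] (m ^ suc r * repeated x + (a * r + b) * m ^ r)
      ≡⟨ ∑-distrib-+ (λ x → m ^ suc r * repeated x) (λ _ → (a * r + b) * m ^ r) ⟩
    ∑[ x < m ] (m ^ suc r * repeated x) + ∑[ x < m ] ((a * r + b) * m ^ r)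
      ≡⟨ cong₂ _+_ (sym (*-distribˡ-sum (m ^ suc r) repeated)) (sum-const m _) ⟩
    m ^ suc r * count (λ x → any? (λ i → D i ≟ x)) + m * ((a * r + b) * m ^ r)
      ≤⟨ +-monoˡ-≤ _ (*-monoʳ-≤ (m ^ suc r) (≤-trans (count-image D) j≤a)) ⟩
    m ^ suc r * a + m * ((a * r + b) * m ^ r)
      ≡⟨ identity m (m ^ r) a r b ⟩
    (a * suc r + b) * m ^ suc r ∎
    where
    open ≤-Reasoning
    identity : ∀ m M a r b → m * M * a + m * ((a * r + b) * M) ≡ (a * (1 + r) + b) * (m * M)
    identity = solve-∀
    j≤a : j ≤ a
    j≤a = subst (j ≤_) j+r≡a (m≤m+n j (suc r))
    repeated : Fin m → ℕ
    repeated x = indicator (does (any? (λ i → D i ≟ x)))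
    row-bound : ∀ x → stars r c (λ y → P? y ×-dec ψ x y ≟ c) ≤ m ^ suc r * repeated x + (a * r + b) * m ^ r
    row-bound x with any? (λ i → D i ≟ x)
    ... | yes _   = ≤-trans (stars≤ r c _) (≤-trans (≤-reflexive (sym (*-identityʳ _))) (m≤m+n _ _))
    ... | no x∉D = ≤-trans (stars-bound c r (x ∷ D) (∷-injective (λ i Dᵢ≡x → x∉D (i , Dᵢ≡x)) D-injective)
                             (trans (sym (+-suc j r)) j+r≡a) _ x∷D-P no-biclique)
                           (m≤n+m _ _)
      where
      x∷D-P : ∀ y → P y × ψ x y ≡ c → ∀ i → ψ ((x ∷ D) i) y ≡ c
      x∷D-P y (_ , ψxy≡c) zero    = ψxy≡c
      x∷D-P y (Py , _)    (suc i) = D-P y Py i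

  ∑-degree : ∑[ c < k ] ∑[ y < m ] degree c y ≡ m * m
  ∑-degree = begin
    ∑[ c < k ] ∑[ y < m ] degree c y ≡⟨ ∑-comm (λ c y → degree c y) ⟩
    ∑[ y < m ] ∑[ c < k ] degree c y ≡⟨ sum-cong-≗ (λ y → ∑-fibres (λ x → ψ x y)) ⟩
    ∑[ y < m ] m                     ≡⟨ sum-const m m ⟩
    m * m                            ∎
    where open ≡-Reasoning

  kővári-sós-turán : ∀ e b → ¬ MonochromaticBiclique ψ (suc e) b → m ≤ (suc e * suc e + b) * k ^ suc e
  kővári-sós-turán e b no-biclique = cancel m (subst₂ _≤_ lhs rhs chain)
    where
    open ≤-Reasoning
    a = suc e
    bound = (a * a + b) * m ^ a
    stars-a≤bound : ∀ c → ∑[ y < m ] (degree c y ^ a) ≤ bound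
    stars-a≤bound c =
      subst (_≤ bound) (trans (stars-degree a c U?) (sum-cong-≗ λ y → *-identityˡ (degree c y ^ a)))
            (stars-bound c a {0} (λ ()) (λ { {()} }) refl U? (λ _ _ ()) no-biclique)
    chain : (m * m) ^ a ≤ k ^ e * (m ^ e * (k * bound))
    chain = begin
      (m * m) ^ a                                       ≡⟨ cong (_^ a) ∑-degree ⟨
      (∑[ c < k ] ∑[ y < m ] degree c y) ^ a            ≤⟨ power-mean (λ c → ∑[ y < m ] degree c y) e ⟩
      k ^ e * ∑[ c < k ] ((∑[ y < m ] degree c y) ^ a)
        ≤⟨ *-monoʳ-≤ (k ^ e) (sum-mono-≤ λ c → power-mean (degree c) e) ⟩
      k ^ e * ∑[ c < k ] (m ^ e * ∑[ y < m ] (degree c y ^ a))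
        ≡⟨ cong (k ^ e *_) (*-distribˡ-sum (m ^ e) (λ c → ∑[ y < m ] (degree c y ^ a))) ⟨
      k ^ e * (m ^ e * ∑[ c < k ] ∑[ y < m ] (degree c y ^ a))
        ≤⟨ *-monoʳ-≤ (k ^ e) (*-monoʳ-≤ (m ^ e) (sum-mono-≤ stars-a≤bound)) ⟩
      k ^ e * (m ^ e * ∑[ c < k ] bound)                ≡⟨ cong (λ x → k ^ e * (m ^ e * x)) (sum-const k bound) ⟩
      k ^ e * (m ^ e * (k * bound))                     ∎
    lhs : (m * m) ^ a ≡ m * (m ^ e * m ^ a)
    lhs = trans (^-distrib-* m m a) (*-assoc m (m ^ e) (m ^ a))
    rhs : k ^ e * (m ^ e * (k * bound)) ≡ (a * a + b) * k ^ a * (m ^ e * m ^ a)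
    rhs = identity (k ^ e) (m ^ e) k (a * a + b) (m ^ a)
      where
      identity : ∀ K M k c A → K * (M * (k * (c * A))) ≡ c * (k * K) * (M * A)
      identity = solve-∀
    cancel : ∀ x {y} → x * (x ^ e * x ^ a) ≤ y * (x ^ e * x ^ a) → x ≤ y
    cancel zero          _  = z≤n
    cancel x@(suc _) {y} le = *-cancelʳ-≤ x y (x ^ e * x ^ a) {{m*n≢0 _ _ {{m^n≢0 x e}} {{m^n≢0 x a}}}} le

-- Copies of K_{p,p} in K_{n,n}

splitAt-injective : ∀ m {n} → Injective _≡_ _≡_ (splitAt m {n})
splitAt-injective m = Injection.injective (↔⇒↣ +↔⊎)

join-injective : ∀ m n → Injective _≡_ _≡_ (join m n)
join-injective m n = Injection.injective (↔⇒↣ (↔-sym +↔⊎))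

⊎-map-injective : ∀ {A B C D : Set} {f : A → C} {g : B → D} →
                  Injective _≡_ _≡_ f → Injective _≡_ _≡_ g → Injective _≡_ _≡_ (Sum.map f g)
⊎-map-injective f-injective g-injective {inj₁ x} {inj₁ y} eq = cong inj₁ (f-injective (inj₁-injective eq))
⊎-map-injective f-injective g-injective {inj₂ x} {inj₂ y} eq = cong inj₂ (g-injective (inj₂-injective eq))

isLeft : ∀ {A B : Set} → A ⊎ B → Bool
isLeft (inj₁ _) = true
isLeft (inj₂ _) = false

toℕ<ᵇ-splitAt : ∀ m {n} (u : Fin (m + n)) → (toℕ u <ᵇ m) ≡ isLeft (splitAt m u)
toℕ<ᵇ-splitAt zero    u       = refl
toℕ<ᵇ-splitAt (suc m) zero    = refl
toℕ<ᵇ-splitAt (suc m) (suc u) with splitAt m u | toℕ<ᵇ-splitAt m u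
... | inj₁ _ | eq = eq
... | inj₂ _ | eq = eq

isLeft-map : ∀ {A B C D : Set} (f : A → C) (g : B → D) s → isLeft (Sum.map f g s) ≡ isLeft s
isLeft-map f g (inj₁ _) = refl
isLeft-map f g (inj₂ _) = refl

colourMatrix : ∀ {n k} → EdgeColouring (K n) k → Fin n → Fin n → Fin k
colourMatrix {n} c x y = col c (x ↑ˡ n) (n ↑ʳ y)

record FewColouredBiclique {n k} (ψ : Fin n → Fin n → Fin k) (R S L : Set) : Set where
  field
    rows           : R → Fin n
    cols           : S → Fin n
    rows-injective : Injective _≡_ _≡_ rows
    cols-injective : Injective _≡_ _≡_ cols
    label          : R → S → L
    palette        : L → Fin k
    colouring      : ∀ x y → ψ (rows x) (cols y) ≡ palette (label x y)

reindex : ∀ {n k} {ψ : Fin n → Fin n → Fin k} {R S L R′ S′ L′ : Set} →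
          R′ ↣ R → S′ ↣ S → L ↔ L′ → FewColouredBiclique ψ R S L → FewColouredBiclique ψ R′ S′ L′
reindex ρ σ λ↔ B = record
  { rows           = rows ∘ Injection.to ρ
  ; cols           = cols ∘ Injection.to σ
  ; rows-injective = Injection.injective ρ ∘ rows-injective
  ; cols-injective = Injection.injective σ ∘ cols-injective
  ; label          = λ x y → Inverse.to λ↔ (label (Injection.to ρ x) (Injection.to σ y))
  ; palette        = palette ∘ Inverse.from λ↔
  ; colouring      = λ x y → trans (colouring _ _) (cong palette (sym (Inverse.strictlyInverseʳ λ↔ _)))
  }
  where open FewColouredBiclique B

module _ {n p} {α β : Fin p → Fin n}
         (α-injective : Injective _≡_ _≡_ α) (β-injective : Injective _≡_ _≡_ β) where

  bicliqueEmbedding : Fin (p + p) → Fin (n + n)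
  bicliqueEmbedding = join n n ∘ Sum.map α β ∘ splitAt p

  bicliqueEmbedding-side : ∀ u → (toℕ (bicliqueEmbedding u) <ᵇ n) ≡ (toℕ u <ᵇ p)
  bicliqueEmbedding-side u = begin
    toℕ (bicliqueEmbedding u) <ᵇ n                        ≡⟨ toℕ<ᵇ-splitAt n (bicliqueEmbedding u) ⟩
    isLeft (splitAt n (bicliqueEmbedding u))              ≡⟨ cong isLeft (splitAt-join n n _) ⟩
    isLeft (Sum.map α β (splitAt p u))                    ≡⟨ isLeft-map α β (splitAt p u) ⟩
    isLeft (splitAt p u)                                  ≡⟨ toℕ<ᵇ-splitAt p u ⟨
    toℕ u <ᵇ p                                            ∎
    where open ≡-Reasoning

  bicliqueCopy : Copy (K p) (K n)
  bicliqueCopy = record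
    { φ   = bicliqueEmbedding
    ; inj = splitAt-injective p ∘ ⊎-map-injective α-injective β-injective ∘ join-injective n n
    ; hom = λ u v uv → trans (cong₂ _xor_ (bicliqueEmbedding-side u) (bicliqueEmbedding-side v)) uv
    }

  module _ {k} (c : EdgeColouring (K n) k) where

    edge-colour : (s t : Fin p ⊎ Fin p) → isLeft s xor isLeft t ≡ true →
                  Σ (Fin p × Fin p) λ (x , y) →
                    col c (join n n (Sum.map α β s)) (join n n (Sum.map α β t)) ≡ colourMatrix c (α x) (β y)
    edge-colour (inj₁ x) (inj₂ y) _ = (x , y) , refl
    edge-colour (inj₂ y) (inj₁ x) _ = (x , y) , symm c _ _

    copy-edge-colour : ∀ u v → adj (K p) u v ≡ true →
                       Σ (Fin p × Fin p) λ (x , y) →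
                         col c (bicliqueEmbedding u) (bicliqueEmbedding v) ≡ colourMatrix c (α x) (β y)
    copy-edge-colour u v uv = edge-colour (splitAt p u) (splitAt p v)
      (trans (sym (cong₂ _xor_ (toℕ<ᵇ-splitAt p u) (toℕ<ᵇ-splitAt p v))) uv)

    few-colours⇒¬AtLeastColours : ∀ {M q} (label : Fin p → Fin p → Fin M) (palette : Fin M → Fin k) →
      (∀ x y → colourMatrix c (α x) (β y) ≡ palette (label x y)) → M < q → ¬ AtLeastColours c bicliqueCopy q
    few-colours⇒¬AtLeastColours label palette colouring M<q (e , e-edge , e-distinct) =
      let i , j , i<j , same-label = pigeonhole M<q (uncurry label ∘ cell) in
      e-distinct i j (Finₚ.<⇒≢ i<j)
        (trans (colour-of i) (trans (cong palette same-label) (sym (colour-of j))))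
      where
      edge = λ i → copy-edge-colour (proj₁ (e i)) (proj₂ (e i)) (e-edge i)
      cell = λ i → proj₁ (edge i)
      colour-of : ∀ i → col c (bicliqueEmbedding (proj₁ (e i))) (bicliqueEmbedding (proj₂ (e i))) ≡
                        palette (uncurry label (cell i))
      colour-of i = trans (proj₂ (edge i)) (colouring _ _)

fewColouredBiclique⇒¬HqColouring : ∀ {n k p M q} (c : EdgeColouring (K n) k) →
  FewColouredBiclique (colourMatrix c) (Fin p) (Fin p) (Fin M) → M < q → ¬ IsHqColouring (K n) (K p) q k c
fewColouredBiclique⇒¬HqColouring {n} c B M<q hq =
  few-colours⇒¬AtLeastColours {n = n} rows-injective cols-injective c label palette colouring M<q
    (hq (bicliqueCopy {n = n} rows-injective cols-injective))
  where open FewColouredBiclique B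

-- The two colour patterns

extend-monochromatic-biclique : ∀ {m e k a b r s} (ψ : Fin (m + e) → Fin (m + e) → Fin k) → r ≤ e → s ≤ e →
  MonochromaticBiclique (λ x y → ψ (x ↑ˡ e) (y ↑ˡ e)) a b →
  FewColouredBiclique ψ (Fin a ⊎ Fin r) (Fin b ⊎ Fin s) (⊤ ⊎ (Fin a × Fin s ⊎ Fin r × (Fin b ⊎ Fin s)))
extend-monochromatic-biclique {m} {e} {k} {a} {b} {r} {s} ψ r≤e s≤e B = record
  { rows           = rows
  ; cols           = cols
  ; rows-injective = ⊎-map-injective D-injective (inject≤-injective′ r≤e) ∘ join-injective m e
  ; cols-injective = ⊎-map-injective E-injective (inject≤-injective′ s≤e) ∘ join-injective m e
  ; label          = label
  ; palette        = palette
  ; colouring      = colouring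
  }
  where
  open MonochromaticBiclique B
    renaming (rows to D; cols to E; rows-injective to D-injective; cols-injective to E-injective)
  rows : Fin a ⊎ Fin r → Fin (m + e)
  rows = join m e ∘ Sum.map D (λ i → inject≤ i r≤e)
  cols : Fin b ⊎ Fin s → Fin (m + e)
  cols = join m e ∘ Sum.map E (λ j → inject≤ j s≤e)
  label : Fin a ⊎ Fin r → Fin b ⊎ Fin s → ⊤ ⊎ (Fin a × Fin s ⊎ Fin r × (Fin b ⊎ Fin s))
  label (inj₁ i) (inj₁ j) = inj₁ tt
  label (inj₁ i) (inj₂ j) = inj₂ (inj₁ (i , j))
  label (inj₂ i) y        = inj₂ (inj₂ (i , y))
  palette : ⊤ ⊎ (Fin a × Fin s ⊎ Fin r × (Fin b ⊎ Fin s)) → Fin k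
  palette (inj₁ _)              = colour
  palette (inj₂ (inj₁ (i , j))) = ψ (rows (inj₁ i)) (cols (inj₂ j))
  palette (inj₂ (inj₂ (i , y))) = ψ (rows (inj₂ i)) (cols y)
  colouring : ∀ x y → ψ (rows x) (cols y) ≡ palette (label x y)
  colouring (inj₁ i) (inj₁ j) = monochromatic i j
  colouring (inj₁ i) (inj₂ j) = refl
  colouring (inj₂ i) y        = refl

constant-rows-and-columns : ∀ {a m k r} (ψ : Fin (a + m) → Fin (a + m) → Fin (suc k)) →
  suc k ^ a * (a + r) ≤ a + m → suc k ^ a * r ≤ m →
  FewColouredBiclique ψ (Fin a ⊎ Fin r) (Fin a ⊎ Fin r) (Fin a ⊎ (Fin a ⊎ Fin r × Fin r))
constant-rows-and-columns {a} {m} {k} {r} ψ cols-fit rows-fit = record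
  { rows           = rows
  ; cols           = cols
  ; rows-injective = ⊎-map-injective id G-injective ∘ join-injective a m
  ; cols-injective = join-injective a r ∘ B-injective
  ; label          = label
  ; palette        = palette
  ; colouring      = colouring
  }
  where
  open ConstantSubset (iterated-pigeonhole a (λ i y → ψ (i ↑ˡ m) y) cols-fit)
    renaming (colour to rowColour; points to B; points-injective to B-injective; constant to B-rowColour)
  open ConstantSubset (iterated-pigeonhole a (λ j z → ψ (a ↑ʳ z) (B (j ↑ˡ r))) rows-fit)
    renaming (colour to colColour; points to G; points-injective to G-injective; constant to G-colColour)
  rows : Fin a ⊎ Fin r → Fin (a + m)
  rows = join a m ∘ Sum.map id G
  cols : Fin a ⊎ Fin r → Fin (a + m)
  cols = B ∘ join a r
  label : Fin a ⊎ Fin r → Fin a ⊎ Fin r → Fin a ⊎ (Fin a ⊎ Fin r × Fin r)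
  label (inj₁ i) _        = inj₁ i
  label (inj₂ z) (inj₁ j) = inj₂ (inj₁ j)
  label (inj₂ z) (inj₂ j) = inj₂ (inj₂ (z , j))
  palette : Fin a ⊎ (Fin a ⊎ Fin r × Fin r) → Fin (suc k)
  palette (inj₁ i)              = rowColour i
  palette (inj₂ (inj₁ j))       = colColour j
  palette (inj₂ (inj₂ (z , j))) = ψ (rows (inj₂ z)) (cols (inj₂ j))
  colouring : ∀ x y → ψ (rows x) (cols y) ≡ palette (label x y)
  colouring (inj₁ i) y        = B-rowColour i (join a r y)
  colouring (inj₂ z) (inj₁ j) = G-colColour j z
  colouring (inj₂ z) (inj₂ j) = refl

split≤ : ∀ {a p} → a ≤ p → Fin p ↔ (Fin a ⊎ Fin (p ∸ a))
split≤ {a} {p} a≤p = subst (λ t → Fin t ↔ (Fin a ⊎ Fin (p ∸ a))) (m+[n∸m]≡n a≤p) +↔⊎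

Fin↔labels₁ : ∀ {a b r s} → Fin (1 + (a * s + r * (b + s))) ↔ (⊤ ⊎ (Fin a × Fin s ⊎ Fin r × (Fin b ⊎ Fin s)))
Fin↔labels₁ = (1↔⊤ ⊎-↔ ((*↔× ⊎-↔ ((↔-id _ ×-↔ +↔⊎) ↔-∘ *↔×)) ↔-∘ +↔⊎)) ↔-∘ +↔⊎

Fin↔labels₂ : ∀ {a r} → Fin (a + (a + r * r)) ↔ (Fin a ⊎ (Fin a ⊎ Fin r × Fin r))
Fin↔labels₂ = (↔-id _ ⊎-↔ ((↔-id _ ⊎-↔ *↔×) ↔-∘ +↔⊎)) ↔-∘ +↔⊎

labels<q₁ : ∀ {a b p} → a ≤ p → b ≤ p → 1 + (a * (p ∸ b) + (p ∸ a) * (b + (p ∸ b))) < p * p ∸ a * b + 2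
labels<q₁ {a} {b} {p} a≤p b≤p =
  subst (λ t → 1 + M < t + 2) M≡p²∸ab (≤-reflexive (+-comm 2 M))
  where
  M = a * (p ∸ b) + (p ∸ a) * (b + (p ∸ b))
  identity : ∀ a b r s → a * b + (a * s + r * (b + s)) ≡ (a + r) * (b + s)
  identity = solve-∀
  M≡p²∸ab : M ≡ p * p ∸ a * b
  M≡p²∸ab = begin
    M                                    ≡⟨ m+n∸m≡n (a * b) M ⟨
    a * b + M ∸ a * b                    ≡⟨ cong (_∸ a * b) (identity a b (p ∸ a) (p ∸ b)) ⟩
    (a + (p ∸ a)) * (b + (p ∸ b)) ∸ a * b
                                         ≡⟨ cong₂ (λ x y → x * y ∸ a * b) (m+[n∸m]≡n a≤p) (m+[n∸m]≡n b≤p) ⟩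
    p * p ∸ a * b                        ∎
    where open ≡-Reasoning

labels<q₂ : ∀ {a p} → 2 ≤ a → a ≤ p → a + (a + (p ∸ a) * (p ∸ a)) < p * p ∸ a * (2 * p ∸ a ∸ 2) + 1
labels<q₂ {suc zero} (s≤s ())
labels<q₂ {suc (suc a′)} {p} _ a≤p with m≤n⇒∃[o]m+o≡n a≤p
... | r , refl = subst (λ t → M < t + 1) M≡p²∸aw (≤-reflexive (+-comm 1 M))
  where
  a = suc (suc a′)
  M = a + (a + (a + r ∸ a) * (a + r ∸ a))
  w≡a′+2r : 2 * (a + r) ∸ a ∸ 2 ≡ a′ + 2 * r
  w≡a′+2r = begin
    2 * (a + r) ∸ a ∸ 2             ≡⟨ cong (λ x → x ∸ a ∸ 2) (identity₁ a′ r) ⟩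
    a + (2 + (a′ + 2 * r)) ∸ a ∸ 2  ≡⟨ cong (_∸ 2) (m+n∸m≡n a (2 + (a′ + 2 * r))) ⟩
    2 + (a′ + 2 * r) ∸ 2            ≡⟨ m+n∸m≡n 2 (a′ + 2 * r) ⟩
    a′ + 2 * r                      ∎
    where
    open ≡-Reasoning
    identity₁ : ∀ a′ r → 2 * (2 + a′ + r) ≡ 2 + a′ + (2 + (a′ + 2 * r))
    identity₁ = solve-∀
  M≡p²∸aw : M ≡ (a + r) * (a + r) ∸ a * (2 * (a + r) ∸ a ∸ 2)
  M≡p²∸aw = begin
    M                                                 ≡⟨ cong (λ x → a + (a + x * x)) (m+n∸m≡n a r) ⟩
    a + (a + r * r)                                   ≡⟨ m+n∸m≡n (a * (a′ + 2 * r)) _ ⟨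
    a * (a′ + 2 * r) + (a + (a + r * r)) ∸ a * (a′ + 2 * r)
                                                      ≡⟨ cong (_∸ a * (a′ + 2 * r)) (identity₂ a′ r) ⟩
    (a + r) * (a + r) ∸ a * (a′ + 2 * r)              ≡⟨ cong (λ x → (a + r) * (a + r) ∸ a * x) w≡a′+2r ⟨
    (a + r) * (a + r) ∸ a * (2 * (a + r) ∸ a ∸ 2)     ∎
    where
    open ≡-Reasoning
    identity₂ : ∀ a′ r →
                (2 + a′) * (a′ + 2 * r) + ((2 + a′) + ((2 + a′) + r * r)) ≡ (2 + a′ + r) * (2 + a′ + r)
    identity₂ = solve-∀

hqColouring-bound₁ : ∀ {p b m k} e → suc e ≤ b → b ≤ p → (c : EdgeColouring (K (m + p)) k) →
  IsHqColouring (K (m + p)) (K p) (p * p ∸ suc e * b + 2) k c → m ≤ (suc e * suc e + b) * k ^ suc e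
hqColouring-bound₁ {p} {b} e a≤b b≤p c hq =
  kővári-sós-turán (λ x y → colourMatrix c (x ↑ˡ p) (y ↑ˡ p)) e b λ B →
  fewColouredBiclique⇒¬HqColouring c
    (reindex (↔⇒↣ (split≤ a≤p)) (↔⇒↣ (split≤ b≤p)) (↔-sym Fin↔labels₁)
      (extend-monochromatic-biclique (colourMatrix c) (m∸n≤m p (suc e)) (m∸n≤m p b) B))
    (labels<q₁ a≤p b≤p) hq
  where a≤p = ≤-trans a≤b b≤p

hqColouring-bound₂ : ∀ {p a m k} → 2 ≤ a → a ≤ p → (c : EdgeColouring (K (a + m)) (suc k)) →
  IsHqColouring (K (a + m)) (K p) (p * p ∸ a * (2 * p ∸ a ∸ 2) + 1) (suc k) c → m < suc k ^ a * p
hqColouring-bound₂ {p} {a} {m} {k} 2≤a a≤p c hq = ≰⇒> λ fits →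
  fewColouredBiclique⇒¬HqColouring c
    (reindex (↔⇒↣ (split≤ a≤p)) (↔⇒↣ (split≤ a≤p)) (↔-sym Fin↔labels₂)
      (constant-rows-and-columns (colourMatrix c)
        (subst (λ t → suc k ^ a * t ≤ a + m) (sym (m+[n∸m]≡n a≤p)) (≤-trans fits (m≤n+m m a)))
        (≤-trans (*-monoʳ-≤ (suc k ^ a) (m∸n≤m p a)) fits)))
    (labels<q₂ 2≤a a≤p) hq

m≤m*[1+k]^a : ∀ m k a → m ≤ m * suc k ^ a
m≤m*[1+k]^a m k a = m≤m*n m (suc k ^ a) {{m^n≢0 (suc k) a}}

¬EdgeColouring-0 : ∀ {n} → ¬ EdgeColouring (K (suc n)) 0
¬EdgeColouring-0 c with col c zero zero
... | ()

lower-bound₁ : ∀ {p a b} → 1 ≤ a → a ≤ b → b ≤ p →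
  ∀ n k → HasHqColouring (K n) (K p) (p * p ∸ a * b + 2) k → n ≤ (a * a + b + p) * k ^ a
lower-bound₁ _ _ _ zero    k       _       = z≤n
lower-bound₁ _ _ _ (suc n) zero    (c , _) = ⊥-elim (¬EdgeColouring-0 c)
lower-bound₁ {p} {a@(suc e)} {b} _ a≤b b≤p n (suc k) (c , hq) with p ≤? n
... | no p≰n = ≤-trans (<⇒≤ (≰⇒> p≰n)) (≤-trans (m≤n+m p (a * a + b)) (m≤m*[1+k]^a _ k a))
... | yes p≤n with m≤n⇒∃[o]m+o≡n p≤n
...   | m , p+m≡n with trans (+-comm m p) p+m≡n
...     | refl = begin
  m + p                                   ≤⟨ +-mono-≤ (hqColouring-bound₁ e a≤b b≤p c hq) (m≤m*[1+k]^a p k a) ⟩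
  (a * a + b) * suc k ^ a + p * suc k ^ a  ≡⟨ *-distribʳ-+ (suc k ^ a) (a * a + b) p ⟨
  (a * a + b + p) * suc k ^ a             ∎
  where open ≤-Reasoning

lower-bound₂ : ∀ {p a} → 2 ≤ a → a ≤ p →
  ∀ n k → HasHqColouring (K n) (K p) (p * p ∸ a * (2 * p ∸ a ∸ 2) + 1) k → n ≤ (p + a) * k ^ a
lower-bound₂ _ _ zero    k       _       = z≤n
lower-bound₂ _ _ (suc n) zero    (c , _) = ⊥-elim (¬EdgeColouring-0 c)
lower-bound₂ {p} {a} 2≤a a≤p n (suc k) (c , hq) with a ≤? n
... | no a≰n = ≤-trans (<⇒≤ (≰⇒> a≰n)) (≤-trans (m≤n+m a p) (m≤m*[1+k]^a _ k a))
... | yes a≤n with m≤n⇒∃[o]m+o≡n a≤n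
...   | m , refl = begin
  a + m                               ≤⟨ +-mono-≤ (m≤m*[1+k]^a a k a) (<⇒≤ (hqColouring-bound₂ 2≤a a≤p c hq)) ⟩
  a * suc k ^ a + suc k ^ a * p       ≡⟨ identity a p (suc k ^ a) ⟩
  (p + a) * suc k ^ a                 ∎
  where
  open ≤-Reasoning
  identity : ∀ a p x → a * x + x * p ≡ (p + a) * x
  identity = solve-∀

corollary1p14 : (p a b : ℕ) → 2 ≤ a → a ≤ b → b ≤ p →
    ((2 * p ≤ a * b →
      Σ ℕ λ C → Σ ℕ λ N → ∀ n → N ≤ n → ∀ k →
        HasHqColouring (K n) (K p) (p * p ∸ a * b + 2) k → n ≤ C * k ^ a)
    ×
    (2 * p ∸ 1 ≤ a * (2 * p ∸ a ∸ 2) →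
      Σ ℕ λ C → Σ ℕ λ N → ∀ n → N ≤ n → ∀ k →
        HasHqColouring (K n) (K p) (p * p ∸ a * (2 * p ∸ a ∸ 2) + 1) k → n ≤ C * k ^ a))
corollary1p14 p a b 2≤a a≤b b≤p =
  (λ _ → a * a + b + p , 0 , λ n _ → lower-bound₁ (≤-trans (s≤s z≤n) 2≤a) a≤b b≤p n) ,
  (λ _ → p + a , 0 , λ n _ → lower-bound₂ 2≤a (≤-trans a≤b b≤p) n)
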